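{- Let $(\mathcal{F},\mathcal{G})$ be a Cross-Sperner pair of nonempty families of subsets of $[n]$, and let $X=\bigcap_{A\in\mathcal{F}}A$ and $Y=\bigcap_{B\in\mathcal{G}}B$. Suppose $X\cup Y=[n]$ and $X\cap Y=\emptyset$. Let $\mathcal{F}'=\{A\cup Y: A\subsetneq X\}$ and $\mathcal{G}'=\{B\cup X: B\subsetneq Y\}$. Then $(\mathcal{F}',\mathcal{G}')$ is a Cross-Sperner pair, $\mathcal{I}(\mathcal{F},\mathcal{G})\subseteq\mathcal{I}(\mathcal{F}',\mathcal{G}')$, and hence $|\mathcal{I}(\mathcal{F},\mathcal{G})|\le|\mathcal{I}(\mathcal{F}',\mathcal{G}')|$.
   Context: A pair $(\mathcal{F},\mathcal{G})$ of families $\mathcal{F},\mathcal{G}\subseteq 2^{[n]}$ is called Cross-Sperner if for all $A\in\mathcal{F}$ and $B\in\mathcal{G}$, neither $A\subseteq B$ nor $B\subseteq A$. For families $\mathcal{F},\mathcal{G}$ set $\mathcal{I}(\mathcal{F},\mathcal{G})=\{A\cap B: A\in\mathcal{F},B\in\mathcal{G}\}$. Here $A\subsetneq X$ means $A$ is a proper subset of $X$ (possibly empty). -}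

module Defs where

open import Data.Nat using (ℕ; zero; suc)
open import Data.Bool using (Bool; true; false; _∧_)
open import Data.List using (List; []; _∷_; map; _++_; filter; length)
open import Data.Bool.ListAction using (any)
open import Data.Vec using (_∷_; [])
open import Data.Fin.Subset using (Subset; _∩_; _∪_; _⊆_; _⊂_; ⋂; inside; outside)
open import Data.Bool.Properties using () renaming (_≟_ to _≟ᵇ_)
open import Data.Vec.Properties using (≡-dec)
open import Data.Fin.Subset.Properties using (_⊂?_)
open import Relation.Nullary using (¬_; ⌊_⌋; Dec)
open import Relation.Binary.PropositionalEquality using (_≡_)
open import Data.Product using (_×_)

Family : ℕ → Set
Family n = Subset n → Bool

_∈F_ : ∀ {n} → Subset n → Family n → Set
A ∈F 𝓕 = 𝓕 A ≡ true

allSubsets : (n : ℕ) → List (Subset n)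
allSubsets zero = [] ∷ []
allSubsets (suc n) = map (outside ∷_) (allSubsets n) ++ map (inside ∷_) (allSubsets n)

members : ∀ {n} → Family n → List (Subset n)
members {n} 𝓕 = filter (λ A → 𝓕 A ≟ᵇ true) (allSubsets n)

card : ∀ {n} → Family n → ℕ
card 𝓕 = length (members 𝓕)

Nonempty : ∀ {n} → Family n → Set
Nonempty 𝓕 = ¬ (members 𝓕 ≡ [])

-- intersection of all members of a family (the whole set [n] for the empty family)
⋂F : ∀ {n} → Family n → Subset n
⋂F 𝓕 = ⋂ (members 𝓕)

_⊆F_ : ∀ {n} → Family n → Family n → Set
𝓕 ⊆F 𝓖 = ∀ A → A ∈F 𝓕 → A ∈F 𝓖

CrossSperner : ∀ {n} → Family n → Family n → Set
CrossSperner 𝓕 𝓖 = ∀ A B → A ∈F 𝓕 → B ∈F 𝓖 → ¬ (A ⊆ B) × ¬ (B ⊆ A)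

_≟S_ : ∀ {n} (A B : Subset n) → Dec (A ≡ B)
_≟S_ = ≡-dec _≟ᵇ_

𝓘 : ∀ {n} → Family n → Family n → Family n
𝓘 𝓕 𝓖 C = any (λ A → any (λ B → ⌊ (A ∩ B) ≟S C ⌋) (members 𝓖)) (members 𝓕)

properUnion : ∀ {n} → Subset n → Subset n → Family n
properUnion {n} W Z D = any (λ A → ⌊ A ⊂? W ⌋ ∧ ⌊ (A ∪ Z) ≟S D ⌋) (allSubsets n)

-- Write X = ⋂𝓕 and Y = ⋂𝓖; they partition [n], and X ⊆ A, Y ⊆ B for A ∈ 𝓕, B ∈ 𝓖.
-- Then A ∩ B = (B ∩ X) ∪ (A ∩ Y) = ((B ∩ X) ∪ Y) ∩ ((A ∩ Y) ∪ X). Here B ∩ X ⊊ X, since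
-- otherwise B ⊇ X ∪ Y = [n] ⊇ A, and symmetrically A ∩ Y ⊊ Y; so every member of 𝓘(𝓕,𝓖)
-- is a member of 𝓘(𝓕',𝓖'). Members A' ∪ Y of 𝓕' and B' ∪ X of 𝓖' are incomparable because
-- Y ∖ B' is a nonempty part of the first that misses the second, and symmetrically.
module Submission where

open import Defs
open import Data.Nat using (ℕ; _≤_)
open import Data.Bool using (Bool; true)
open import Data.Bool.Properties using (T-≡; T-∧) renaming (_≟_ to _≟ᵇ_)
open import Data.Bool.ListAction using (any)
open import Data.Fin.Properties using (¬∀⟶∃¬)
open import Data.Fin.Subset using (Subset; _∩_; _∪_; ⊤; ⊥; _∈_; _∉_; _⊆_; _⊈_; _⊂_; ⋂; inside; outside)
open import Data.Fin.Subset.Properties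
  using (x∈p∩q⁺; x∈p∩q⁻; x∈p∪q⁺; x∈p∪q⁻; p∩q⊆q; ∈⊤; ∉⊥; ⊆-antisym; ∩-comm; ∪-comm; _⊂?_; _∈?_)
open import Data.List using (List; _∷_)
open import Data.List.Membership.Propositional using (find; lose) renaming (_∈_ to _∈ᴸ_)
open import Data.List.Membership.Propositional.Properties using (∈-filter⁺; ∈-filter⁻; ∈-map⁺; ∈-++⁺ˡ; ∈-++⁺ʳ)
open import Data.List.Relation.Unary.Any using (here; there)
import Data.List.Relation.Unary.Any as Any
open import Data.List.Relation.Unary.Any.Properties using (any⁺; any⁻)
open import Data.List.Relation.Binary.Sublist.Propositional using (⊆-refl)
open import Data.List.Relation.Binary.Sublist.Propositional.Properties using (filter⁺)
open import Data.List.Relation.Binary.Sublist.Heterogeneous.Properties using (length-mono-≤)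
open import Data.Product using (_×_; _,_; proj₁; proj₂; ∃; ∃₂)
open import Data.Sum using (_⊎_; inj₁; inj₂; [_,_])
open import Data.Vec using ([]; _∷_)
open import Function using (_∘_; Equivalence)
open import Relation.Nullary using (Dec; yes; no; ⌊_⌋; contradiction)
open import Relation.Nullary.Decidable using (toWitness; fromWitness; _→-dec_)
open import Relation.Binary.PropositionalEquality using (_≡_; refl; sym; trans; subst)

open Equivalence using (to; from)

private
  variable
    n : ℕ

⌊⌋⇒witness : ∀ {a} {A : Set a} (a? : Dec A) → ⌊ a? ⌋ ≡ true → A
⌊⌋⇒witness a? = toWitness {a? = a?} ∘ from T-≡

witness⇒⌊⌋ : ∀ {a} {A : Set a} (a? : Dec A) → A → ⌊ a? ⌋ ≡ true
witness⇒⌊⌋ a? = to T-≡ ∘ fromWitness {a? = a?}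

any≡true⁻ : ∀ {A : Set} (p : A → Bool) xs → any p xs ≡ true → ∃ λ x → x ∈ᴸ xs × p x ≡ true
any≡true⁻ p xs = find ∘ Any.map (to T-≡) ∘ any⁻ p xs ∘ from T-≡

any≡true⁺ : ∀ {A : Set} (p : A → Bool) {x xs} → x ∈ᴸ xs → p x ≡ true → any p xs ≡ true
any≡true⁺ p x∈xs px = to T-≡ (any⁺ p (lose x∈xs (from T-≡ px)))

∈-allSubsets : (A : Subset n) → A ∈ᴸ allSubsets n
∈-allSubsets []          = here refl
∈-allSubsets (outside ∷ A)= ∈-++⁺ˡ (∈-map⁺ (outside ∷_) (∈-allSubsets A))
∈-allSubsets (inside ∷ A) = ∈-++⁺ʳ _ (∈-map⁺ (inside ∷_) (∈-allSubsets A))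

∈-members⁺ : (𝓕 : Family n) {A : Subset n} → A ∈F 𝓕 → A ∈ᴸ members 𝓕
∈-members⁺ 𝓕 {A} = ∈-filter⁺ (λ A → 𝓕 A ≟ᵇ true) (∈-allSubsets A)

∈-members⁻ : (𝓕 : Family n) {A : Subset n} → A ∈ᴸ members 𝓕 → A ∈F 𝓕
∈-members⁻ {n} 𝓕 = proj₂ ∘ ∈-filter⁻ (λ A → 𝓕 A ≟ᵇ true) {xs = allSubsets n}

card-mono : (𝓕 𝓖 : Family n) → 𝓕 ⊆F 𝓖 → card 𝓕 ≤ card 𝓖
card-mono {n} 𝓕 𝓖 𝓕⊆𝓖 = length-mono-≤
  (filter⁺ (λ A → 𝓕 A ≟ᵇ true) (λ A → 𝓖 A ≟ᵇ true) (λ { refl → 𝓕⊆𝓖 _ }) (⊆-refl {x = allSubsets n}))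

⋂-lowerBound : {A : Subset n} (As : List (Subset n)) → A ∈ᴸ As → ⋂ As ⊆ A
⋂-lowerBound (A ∷ As) (here refl) = proj₁ ∘ x∈p∩q⁻ A (⋂ As)
⋂-lowerBound (B ∷ As) (there A∈As) = ⋂-lowerBound As A∈As ∘ proj₂ ∘ x∈p∩q⁻ B (⋂ As)

⋂F-lowerBound : (𝓕 : Family n) {A : Subset n} → A ∈F 𝓕 → ⋂F 𝓕 ⊆ A
⋂F-lowerBound 𝓕 = ⋂-lowerBound (members 𝓕) ∘ ∈-members⁺ 𝓕

∈𝓘⁺ : (𝓕 𝓖 : Family n) {A B : Subset n} → A ∈F 𝓕 → B ∈F 𝓖 → (A ∩ B) ∈F 𝓘 𝓕 𝓖
∈𝓘⁺ 𝓕 𝓖 {A} {B} A∈𝓕 B∈𝓖 =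
  any≡true⁺ _ (∈-members⁺ 𝓕 A∈𝓕)
    (any≡true⁺ _ (∈-members⁺ 𝓖 B∈𝓖) (witness⇒⌊⌋ ((A ∩ B) ≟S (A ∩ B)) refl))

∈𝓘⁻ : (𝓕 𝓖 : Family n) {C : Subset n} → C ∈F 𝓘 𝓕 𝓖 →
      ∃₂ λ A B → A ∈F 𝓕 × B ∈F 𝓖 × A ∩ B ≡ C
∈𝓘⁻ 𝓕 𝓖 {C} C∈𝓘 with any≡true⁻ _ (members 𝓕) C∈𝓘
... | A , A∈𝓕 , ∃B with any≡true⁻ _ (members 𝓖) ∃B
... | B , B∈𝓖 , A∩B≟C =
  A , B , ∈-members⁻ 𝓕 A∈𝓕 , ∈-members⁻ 𝓖 B∈𝓖 , ⌊⌋⇒witness ((A ∩ B) ≟S C) A∩B≟C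

∈properUnion⁺ : (W Z : Subset n) {A : Subset n} → A ⊂ W → (A ∪ Z) ∈F properUnion W Z
∈properUnion⁺ W Z {A} A⊂W = any≡true⁺ _ (∈-allSubsets A)
  (to T-≡ (from T-∧ (fromWitness {a? = A ⊂? W} A⊂W , fromWitness {a? = (A ∪ Z) ≟S (A ∪ Z)} refl)))

∈properUnion⁻ : (W Z : Subset n) {D : Subset n} → D ∈F properUnion W Z →
                ∃ λ A → A ⊂ W × A ∪ Z ≡ D
∈properUnion⁻ {n} W Z D∈ with any≡true⁻ _ (allSubsets n) D∈
... | A , _ , A⊂W∧A∪Z≟D with to (T-∧ {⌊ A ⊂? W ⌋}) (from T-≡ A⊂W∧A∪Z≟D)
... | A⊂W , A∪Z≡D = A , toWitness A⊂W , toWitness A∪Z≡D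

⊈⇒∃∈∉ : {p q : Subset n} → p ⊈ q → ∃ λ x → x ∈ p × x ∉ q
⊈⇒∃∈∉ {n} {p} {q} p⊈q
  with ¬∀⟶∃¬ n (λ x → x ∈ p → x ∈ q) (λ x → x ∈? p →-dec x ∈? q) (λ p⇒q → p⊈q (p⇒q _))
... | x , x∈p↛x∈q with x ∈? p
... | yes x∈p = x , x∈p , λ x∈q → x∈p↛x∈q (λ _ → x∈q)
... | no x∉p  = contradiction (λ x∈p → contradiction x∈p x∉p) x∈p↛x∈q

⊈⇒∩⊂ : {p q : Subset n} → p ⊈ q → q ∩ p ⊂ p
⊈⇒∩⊂ {q = q} p⊈q with ⊈⇒∃∈∉ p⊈q
... | x , x∈p , x∉q = p∩q⊆q q _ , x , x∈p , x∉q ∘ proj₁ ∘ x∈p∩q⁻ q _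

module _ {X Y : Subset n} where

  ∪≡⊤⇒∈⊎∈ : X ∪ Y ≡ ⊤ → ∀ x → x ∈ X ⊎ x ∈ Y
  ∪≡⊤⇒∈⊎∈ X∪Y≡⊤ x = x∈p∪q⁻ X Y (subst (x ∈_) (sym X∪Y≡⊤) ∈⊤)

  ∩≡⊥⇒∉ : X ∩ Y ≡ ⊥ → ∀ {x} → x ∈ X → x ∉ Y
  ∩≡⊥⇒∉ X∩Y≡⊥ x∈X x∈Y = ∉⊥ (subst (_ ∈_) X∩Y≡⊥ (x∈p∩q⁺ (x∈X , x∈Y)))

  ∩⊂-of-⊈ : {A B : Subset n} → X ∪ Y ≡ ⊤ → Y ⊆ B → A ⊈ B → B ∩ X ⊂ X
  ∩⊂-of-⊈ X∪Y≡⊤ Y⊆B A⊈B =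
    ⊈⇒∩⊂ λ X⊆B → A⊈B λ {x} _ → [ X⊆B , Y⊆B ] (∪≡⊤⇒∈⊎∈ X∪Y≡⊤ x)

  ∪⊈∪-of-⊂ : {A B : Subset n} → X ∩ Y ≡ ⊥ → B ⊂ Y → A ∪ Y ⊈ B ∪ X
  ∪⊈∪-of-⊂ {A} {B} X∩Y≡⊥ (_ , y , y∈Y , y∉B) A∪Y⊆B∪X
    with x∈p∪q⁻ B X (A∪Y⊆B∪X (x∈p∪q⁺ (inj₂ y∈Y)))
  ... | inj₁ y∈B = y∉B y∈B
  ... | inj₂ y∈X = ∩≡⊥⇒∉ X∩Y≡⊥ y∈X y∈Y

  ∩-split-by-partition : {A B : Subset n} → X ∪ Y ≡ ⊤ → X ∩ Y ≡ ⊥ → X ⊆ A → Y ⊆ B →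
                         ((B ∩ X) ∪ Y) ∩ ((A ∩ Y) ∪ X) ≡ A ∩ B
  ∩-split-by-partition {A} {B} X∪Y≡⊤ X∩Y≡⊥ X⊆A Y⊆B = ⊆-antisym ⊆A∩B A∩B⊆
    where
    ⊆A∩B : ((B ∩ X) ∪ Y) ∩ ((A ∩ Y) ∪ X) ⊆ A ∩ B
    ⊆A∩B x∈ with x∈p∩q⁻ ((B ∩ X) ∪ Y) _ x∈
    ... | x∈B∩X∪Y , x∈A∩Y∪X with x∈p∪q⁻ (B ∩ X) Y x∈B∩X∪Y | x∈p∪q⁻ (A ∩ Y) X x∈A∩Y∪X
    ... | inj₁ x∈B∩X | _ = x∈p∩q⁺ (X⊆A (proj₂ (x∈p∩q⁻ B X x∈B∩X)) , proj₁ (x∈p∩q⁻ B X x∈B∩X))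
    ... | inj₂ x∈Y | inj₁ x∈A∩Y = x∈p∩q⁺ (proj₁ (x∈p∩q⁻ A Y x∈A∩Y) , Y⊆B x∈Y)
    ... | inj₂ x∈Y | inj₂ x∈X = contradiction x∈Y (∩≡⊥⇒∉ X∩Y≡⊥ x∈X)
    A∩B⊆ : A ∩ B ⊆ ((B ∩ X) ∪ Y) ∩ ((A ∩ Y) ∪ X)
    A∩B⊆ {x} x∈A∩B with x∈p∩q⁻ A B x∈A∩B | ∪≡⊤⇒∈⊎∈ X∪Y≡⊤ x
    ... | _ , x∈B | inj₁ x∈X = x∈p∩q⁺ (x∈p∪q⁺ (inj₁ (x∈p∩q⁺ (x∈B , x∈X))) , x∈p∪q⁺ (inj₂ x∈X))
    ... | x∈A , _ | inj₂ x∈Y = x∈p∩q⁺ (x∈p∪q⁺ (inj₂ x∈Y) , x∈p∪q⁺ (inj₁ (x∈p∩q⁺ (x∈A , x∈Y))))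

lemma2p3 : (n : ℕ) (𝓕 𝓖 : Family n) →
    CrossSperner 𝓕 𝓖 → Nonempty 𝓕 → Nonempty 𝓖 →
    (⋂F 𝓕 ∪ ⋂F 𝓖) ≡ ⊤ → (⋂F 𝓕 ∩ ⋂F 𝓖) ≡ ⊥ →
    CrossSperner (properUnion (⋂F 𝓕) (⋂F 𝓖)) (properUnion (⋂F 𝓖) (⋂F 𝓕))
      × 𝓘 𝓕 𝓖 ⊆F 𝓘 (properUnion (⋂F 𝓕) (⋂F 𝓖)) (properUnion (⋂F 𝓖) (⋂F 𝓕))
      × card (𝓘 𝓕 𝓖) ≤ card (𝓘 (properUnion (⋂F 𝓕) (⋂F 𝓖)) (properUnion (⋂F 𝓖) (⋂F 𝓕)))
lemma2p3 n 𝓕 𝓖 crossSperner _ _ X∪Y≡⊤ X∩Y≡⊥ = crossSperner′ , 𝓘⊆𝓘′ , card-mono _ _ 𝓘⊆𝓘′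
  where
  X = ⋂F 𝓕
  Y = ⋂F 𝓖
  𝓕′ = properUnion X Y
  𝓖′ = properUnion Y X
  Y∪X≡⊤ = trans (∪-comm Y X) X∪Y≡⊤
  Y∩X≡⊥ = trans (∩-comm Y X) X∩Y≡⊥

  crossSperner′ : CrossSperner 𝓕′ 𝓖′
  crossSperner′ _ _ D∈𝓕′ E∈𝓖′ with ∈properUnion⁻ X Y D∈𝓕′ | ∈properUnion⁻ Y X E∈𝓖′
  ... | _ , A⊂X , refl | _ , B⊂Y , refl = ∪⊈∪-of-⊂ X∩Y≡⊥ B⊂Y , ∪⊈∪-of-⊂ Y∩X≡⊥ A⊂X

  𝓘⊆𝓘′ : 𝓘 𝓕 𝓖 ⊆F 𝓘 𝓕′ 𝓖′
  𝓘⊆𝓘′ _ C∈𝓘 with ∈𝓘⁻ 𝓕 𝓖 C∈𝓘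
  ... | A , B , A∈𝓕 , B∈𝓖 , refl =
    subst (_∈F 𝓘 𝓕′ 𝓖′) (∩-split-by-partition X∪Y≡⊤ X∩Y≡⊥ X⊆A Y⊆B)
      (∈𝓘⁺ 𝓕′ 𝓖′ (∈properUnion⁺ X Y (∩⊂-of-⊈ X∪Y≡⊤ Y⊆B A⊈B))
                 (∈properUnion⁺ Y X (∩⊂-of-⊈ Y∪X≡⊤ X⊆A B⊈A)))
    where
    X⊆A = ⋂F-lowerBound 𝓕 A∈𝓕
    Y⊆B = ⋂F-lowerBound 𝓖 B∈𝓖
    A⊈B = proj₁ (crossSperner A B A∈𝓕 B∈𝓖)
    B⊈A = proj₂ (crossSperner A B A∈𝓕 B∈𝓖)
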